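{- Let $n\ge1$, $m\ge 0$, $k\ge0$ be integers. The map $g$ (defined in the context) is an injection from $\mathrm{pRInc}^m_k(2\times n)$ to $\mathrm{RInc}^m_k(2\times n)$, and for every $T\in\mathrm{pRInc}^m_k(2\times n)$: (1) if $T_{2,1}$ appears only once in $T$, then $g(T)_{1,i+1}\le g(T)_{2,i}$ for each $1\le i\le n-1$; (2) $T_{2,1}$ appears twice in $T$ if and only if $g(T)_{1,n}=g(T)_{2,n}$.
   Context: $\mathrm{RInc}^m_k(2\times n)$ denotes the set of $2\times n$ arrays $T=(T_{i,j})$ (row 1 on top) of positive integers with strictly increasing rows, weakly increasing columns ($T_{1,j}\le T_{2,j}$), and set of entries exactly $\{m+1,m+2,\ldots,m+2n-k\}$; thus exactly $k$ numbers appear twice (once in each row). Such a $T$ is prime if for every $j$ with $1\le j\le n-1$ and $T_{1,j+1}=T_{2,j}+1$, the entry $T_{2,j+1}$ also appears in row 1 of $T$; $\mathrm{pRInc}^m_k(2\times n)$ is the set of prime arrays in $\mathrm{RInc}^m_k(2\times n)$. For $T\in\mathrm{pRInc}^m_k(2\times n)$ let $A=\{a_1<\cdots<a_k\}$ be the set of numbers appearing twice in $T$, and for each $i$ let $b_i$ be the entry of row 2 immediately to the left of $a_i$ in row 2, read cyclically (so if $a_i=T_{2,1}$ then $b_i=T_{2,n}$); let $B=\{b_1,\ldots,b_k\}$. Then $g(T)$ is the $2\times n$ array whose second row equals the second row of $T$ and whose first row consists of the entries of $(\text{row 1 of }T)\setminus A$ together with the elements of $B$, listed in increasing order. -}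

module Defs where

open import Data.Nat using (ℕ; zero; suc; _+_; _*_; _∸_; _≤_; _<_; _≤ᵇ_)
open import Data.Nat.Properties using (_≟_)
open import Data.Bool using (if_then_else_)
open import Data.Fin as Fin using (Fin; toℕ; fromℕ; inject₁)
open import Data.Vec as Vec using (Vec; lookup; tabulate; toList)
open import Data.Vec.Membership.Propositional using (_∈_)
open import Data.Vec.Membership.DecPropositional _≟_ using (_∈?_)
open import Data.List as List using (List; []; _∷_; _++_; filter; allFin)
open import Data.Product using (_×_)
open import Data.Sum using (_⊎_)
open import Relation.Nullary using (¬_; ¬?)
open import Relation.Binary.PropositionalEquality using (_≡_)
open import Function.Bundles using (_⇔_)

-- A 2 × n array: row1 is the top row, row2 the bottom row.
-- Column j (1-based in the paper) is index j-1 : Fin n.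
record Tab (n : ℕ) : Set where
  constructor tab
  field
    row1 : Vec ℕ n
    row2 : Vec ℕ n
open Tab public

StrictInc : ∀ {n} → Vec ℕ n → Set
StrictInc {n} v = ∀ (i j : Fin n) → i Fin.< j → lookup v i < lookup v j

Appears : ∀ {n} → Tab n → ℕ → Set
Appears T x = (x ∈ row1 T) ⊎ (x ∈ row2 T)

RInc : (m k n : ℕ) → Tab n → Set
RInc m k n T =
  StrictInc (row1 T) × StrictInc (row2 T) ×
  (∀ (j : Fin n) → lookup (row1 T) j ≤ lookup (row2 T) j) ×
  (∀ (x : ℕ) → Appears T x ⇔ (suc m ≤ x × x ≤ m + (2 * n ∸ k)))

Prime : ∀ {n} → Tab n → Set
Prime {n} T = ∀ (j j' : Fin n) → toℕ j' ≡ suc (toℕ j) →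
  lookup (row1 T) j' ≡ suc (lookup (row2 T) j) → lookup (row2 T) j' ∈ row1 T

PRInc : (m k n : ℕ) → Tab n → Set
PRInc m k n T = RInc m k n T × Prime T

prev : ∀ {n} → Fin n → Fin n
prev {suc n} Fin.zero = fromℕ n
prev {suc n} (Fin.suc i) = inject₁ i

insert : ℕ → List ℕ → List ℕ
insert x [] = x ∷ []
insert x (y ∷ ys) = if x ≤ᵇ y then x ∷ y ∷ ys else y ∷ insert x ys

isort : List ℕ → List ℕ
isort [] = []
isort (x ∷ xs) = insert x (isort xs)

-- i-th element of a list (0-based), default 0
nth : List ℕ → ℕ → ℕ
nth [] _ = 0
nth (x ∷ xs) zero = x
nth (x ∷ xs) (suc i) = nth xs i

-- (row 1 of T) \ A : entries of row 1 not occurring in row 2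
rowOneMinusA : ∀ {n} → Tab n → List ℕ
rowOneMinusA T = filter (λ x → ¬? (x ∈? row2 T)) (toList (row1 T))

-- B : for each a = T_{2,i} appearing twice, the row-2 entry cyclically to its left
setB : ∀ {n} → Tab n → List ℕ
setB {n} T = List.map (λ i → lookup (row2 T) (prev i))
               (filter (λ i → lookup (row2 T) i ∈? row1 T) (allFin n))

g : ∀ {n} → Tab n → Tab n
g T = tab (tabulate (λ i → nth (isort (rowOneMinusA T List.++ setB T)) (toℕ i))) (row2 T)

-- Row 1 of g T is the sorted listing of (row 1 ∖ A) ∪ B, which has exactly n elements: shifting each
-- shared entry a = r₂ p of row 1 to its cyclic left neighbour r₂ (prev p) is injective.  The columns of g T
-- are weakly increasing, and item (1) holds, by counting: the j-th smallest element of a set is ≤ c once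
-- j + 1 of its elements are ≤ c.  The shifted entries of columns ≤ j never exceed r₂ j, except the one
-- coming from T_{2,1}, which wraps around to T_{2,n}; one further element ≤ r₂ j comes from the next
-- column: either its shifted entry, or, if T_{1,j+1} > T_{2,j}, then r₂ j + 1 (which occurs, the entries
-- being an interval) must be T_{1,j+1} or T_{2,j+1}, so primality puts T_{2,j+1} into row 1 and r₂ j into B.
-- Item (2) and injectivity hold because an entry of row 2 lies in row 1 of T exactly when its left
-- neighbour lies in row 1 of g T, so T can be read back off g T.

module Submission where

open import Defs
open import Data.Nat using (ℕ; suc; _+_; _*_; _∸_; _≤_; _<_; _≤ᵇ_; z≤n; s≤s; s≤s⁻¹)
open import Data.Nat.Properties
open import Data.Bool using (true; false; T)
open import Data.Empty using (⊥-elim)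
open import Data.Fin as Fin using (Fin; zero; toℕ; fromℕ; punchIn)
import Data.Fin.Properties as Finₚ
open import Data.Vec as Vec using (Vec; lookup; toList)
open import Data.Vec.Functional using (Vector) renaming (_∷_ to _◂_)
open import Data.List as List using (List; []; _∷_; _++_; filter; allFin; length)
open import Data.List.Membership.Propositional using () renaming (_∈_ to _∈ₗ_)
open import Data.List.Relation.Unary.Any using (here; there)
open import Data.List.Relation.Unary.All as All using (All; []; _∷_)
open import Data.List.Relation.Unary.AllPairs as AllPairs using (AllPairs; []; _∷_)
import Data.List.Relation.Unary.AllPairs.Properties as AllPairsₚ
open import Data.List.Relation.Binary.Permutation.Propositional using (_↭_; ↭-refl; ↭-prep; ↭-swap; ↭-trans; ↭-sym)
open import Data.List.Relation.Binary.Permutation.Propositional.Properties using (∈-resp-↭; ↭-length)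
open import Data.List.Relation.Unary.Unique.Propositional using (Unique)
import Data.List.Properties as Listₚ
open import Data.Product using (_×_; _,_; proj₁; proj₂; ∃; ∃₂)
open import Data.Sum using (_⊎_; inj₁; inj₂)
open import Function using (_∘_)
open import Function.Definitions using (Injective)
open import Relation.Nullary using (¬_; ¬?; yes; no; contradiction)
open import Relation.Unary using (Decidable)
open import Relation.Binary.Definitions using (tri<; tri≈; tri>)
open import Relation.Binary.PropositionalEquality
open import Data.Vec.Membership.Propositional using (_∈_)
open import Data.Vec.Membership.DecPropositional _≟_ using (_∈?_)
import Data.Vec.Membership.Propositional.Properties as Vec∈ₚ
import Data.Vec.Relation.Unary.Any as VecAny
import Data.Vec.Relation.Unary.Any.Properties as VecAnyₚ
import Data.List.Membership.Propositional.Properties as List∈ₚ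
import Data.List.Relation.Unary.Unique.Propositional.Properties as Uniqueₚ
import Data.Vec.Properties as Vecₚ
open import Function.Bundles using (_⇔_; mk⇔; Equivalence)

StrictlySorted : List ℕ → Set
StrictlySorted = AllPairs _<_

nth-∈ : ∀ xs {i} → i < length xs → nth xs i ∈ₗ xs
nth-∈ (x ∷ xs) {0}     _         = here refl
nth-∈ (x ∷ xs) {suc i} (s≤s i<n) = there (nth-∈ xs i<n)

∈⇒nth : ∀ {x xs} → x ∈ₗ xs → ∃ λ i → i < length xs × nth xs i ≡ x
∈⇒nth (here refl) = 0 , s≤s z≤n , refl
∈⇒nth (there x∈xs) with ∈⇒nth x∈xs
... | i , i<n , eq = suc i , s≤s i<n , eq

nth-mono-< : ∀ {xs} → StrictlySorted xs → ∀ {i j} → i < j → j < length xs → nth xs i < nth xs j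
nth-mono-< {x ∷ xs} (x< ∷ _)  {0}     {suc j} _         (s≤s j<n) = All.lookup x< (nth-∈ xs j<n)
nth-mono-< {x ∷ xs} (_ ∷ xs↑) {suc i} {suc j} (s≤s i<j) (s≤s j<n) = nth-mono-< xs↑ i<j j<n

nth-mono-≤ : ∀ {xs} → StrictlySorted xs → ∀ {i j} → i ≤ j → j < length xs → nth xs i ≤ nth xs j
nth-mono-≤ xs↑ {i} {j} i≤j j<n with i ≟ j
... | yes refl = ≤-refl
... | no  i≢j  = <⇒≤ (nth-mono-< xs↑ (≤∧≢⇒< i≤j i≢j) j<n)

insert-↭ : ∀ x ys → insert x ys ↭ x ∷ ys
insert-↭ x []       = ↭-refl
insert-↭ x (y ∷ ys) with x ≤ᵇ y
... | true  = ↭-refl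
... | false = ↭-trans (↭-prep y (insert-↭ x ys)) (↭-swap y x ↭-refl)

isort-↭ : ∀ xs → isort xs ↭ xs
isort-↭ []       = ↭-refl
isort-↭ (x ∷ xs) = ↭-trans (insert-↭ x (isort xs)) (↭-prep x (isort-↭ xs))

insert-sorted : ∀ {x ys} → StrictlySorted ys → ¬ x ∈ₗ ys → StrictlySorted (insert x ys)
insert-sorted {x} {[]}     _          _    = [] ∷ []
insert-sorted {x} {y ∷ ys} (y< ∷ ys↑) x∉ys with x ≤ᵇ y in x≤ᵇy
... | true  = (x<y ∷ All.map (<-trans x<y) y<) ∷ y< ∷ ys↑
  where
  x<y : x < y
  x<y = ≤∧≢⇒< (≤ᵇ⇒≤ x y (subst T (sym x≤ᵇy) _)) (x∉ys ∘ here)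
... | false = All.tabulate y<insert ∷ insert-sorted ys↑ (x∉ys ∘ there)
  where
  y<insert : ∀ {z} → z ∈ₗ insert x ys → y < z
  y<insert z∈ with ∈-resp-↭ (insert-↭ x ys) z∈
  ... | here refl  = ≰⇒> (λ x≤y → subst T x≤ᵇy (≤⇒≤ᵇ x≤y))
  ... | there z∈ys = All.lookup y< z∈ys

isort-sorted : ∀ {xs} → Unique xs → StrictlySorted (isort xs)
isort-sorted {[]}     []           = []
isort-sorted {x ∷ xs} (x∉xs ∷ xs!) =
  insert-sorted (isort-sorted xs!) (λ x∈ → All.lookup x∉xs (∈-resp-↭ (isort-↭ xs) x∈) refl)

∈-tail : ∀ {x xs z ys} → All (x <_) xs → z ∈ₗ xs → z ∈ₗ x ∷ ys → z ∈ₗ ys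
∈-tail x< z∈xs (here refl) = contradiction (All.lookup x< z∈xs) (<-irrefl refl)
∈-tail _  _    (there z∈ys) = z∈ys

strictlySorted-heads-≡ : ∀ {x xs y ys} → All (x <_) xs → All (y <_) ys →
  x ∈ₗ y ∷ ys → y ∈ₗ x ∷ xs → x ≡ y
strictlySorted-heads-≡ _  _  (here x≡y)  _           = x≡y
strictlySorted-heads-≡ _  _  (there _)   (here y≡x)  = sym y≡x
strictlySorted-heads-≡ x< y< (there x∈ys) (there y∈xs) =
  contradiction (All.lookup y< x∈ys) (<-asym (All.lookup x< y∈xs))

strictlySorted-≡ : ∀ {xs ys} → StrictlySorted xs → StrictlySorted ys →
  (∀ {z} → z ∈ₗ xs → z ∈ₗ ys) → (∀ {z} → z ∈ₗ ys → z ∈ₗ xs) → xs ≡ ys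
strictlySorted-≡ {[]}     {[]}     _          _          _   _   = refl
strictlySorted-≡ {[]}     {y ∷ ys} _          _          _   ys⊆ = contradiction (ys⊆ (here refl)) λ ()
strictlySorted-≡ {x ∷ xs} {[]}     _          _          xs⊆ _   = contradiction (xs⊆ (here refl)) λ ()
strictlySorted-≡ {x ∷ xs} {y ∷ ys} (x< ∷ xs↑) (y< ∷ ys↑) xs⊆ ys⊆
  with refl ← strictlySorted-heads-≡ x< y< (xs⊆ (here refl)) (ys⊆ (here refl)) =
  cong (x ∷_) (strictlySorted-≡ xs↑ ys↑
    (λ z∈xs → ∈-tail x< z∈xs (xs⊆ (there z∈xs)))
    (λ z∈ys → ∈-tail y< z∈ys (ys⊆ (there z∈ys))))

toList≡tabulate-lookup : ∀ {n} (v : Vec ℕ n) → toList v ≡ List.tabulate (lookup v)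
toList≡tabulate-lookup Vec.[]       = refl
toList≡tabulate-lookup (x Vec.∷ v) = cong (x ∷_) (toList≡tabulate-lookup v)

strictInc⇒sorted : ∀ {n} (v : Vec ℕ n) → StrictInc v → StrictlySorted (toList v)
strictInc⇒sorted v v↑ =
  subst StrictlySorted (sym (toList≡tabulate-lookup v)) (AllPairsₚ.tabulate⁺-< (v↑ _ _))

length-filter-map : ∀ {A : Set} {P : ℕ → Set} (P? : Decidable P) (f : A → ℕ) xs →
  length (filter P? (List.map f xs)) ≡ length (filter (P? ∘ f) xs)
length-filter-map P? f []       = refl
length-filter-map P? f (x ∷ xs) with P? (f x)
... | yes _ = cong suc (length-filter-map P? f xs)
... | no  _ = length-filter-map P? f xs

length-filter-∁ : ∀ {P : ℕ → Set} (P? : Decidable P) xs →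
  length (filter (¬? ∘ P?) xs) + length (filter P? xs) ≡ length xs
length-filter-∁ P? []       = refl
length-filter-∁ P? (x ∷ xs) with P? x
... | yes _ = trans (+-suc _ _) (cong suc (length-filter-∁ P? xs))
... | no  _ = cong suc (length-filter-∁ P? xs)

◂-injective : ∀ {n e} {f : Vector ℕ n} → Injective _≡_ _≡_ f → (∀ q → f q ≢ e) →
  Injective _≡_ _≡_ (e ◂ f)
◂-injective f-inj e∉f {zero}      {zero}      _  = refl
◂-injective f-inj e∉f {zero}      {Fin.suc q} eq = contradiction (sym eq) (e∉f q)
◂-injective f-inj e∉f {Fin.suc p} {zero}      eq = contradiction eq (e∉f p)
◂-injective f-inj e∉f {Fin.suc p} {Fin.suc q} eq = cong Fin.suc (f-inj eq)

module _ {Z : List ℕ} (Z↑ : StrictlySorted Z) {j c : ℕ} (j<len : j < length Z) where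

  nth-≤-of-injection : (f : Fin (suc j) → ℕ) → Injective _≡_ _≡_ f →
    (∀ q → f q ∈ₗ Z) → (∀ q → f q ≤ c) → nth Z j ≤ c
  nth-≤-of-injection f f-inj f∈Z f≤c with nth Z j ≤? c
  ... | yes ≤c = ≤c
  ... | no  ≰c = ⊥-elim (no-collision (Finₚ.pigeonhole ≤-refl position))
    where
    index : Fin (suc j) → ℕ
    index q = proj₁ (∈⇒nth (f∈Z q))
    nth-index : ∀ q → nth Z (index q) ≡ f q
    nth-index q = proj₂ (proj₂ (∈⇒nth (f∈Z q)))
    index<j : ∀ q → index q < j
    index<j q = ≰⇒> λ j≤index → ≰c (begin
      nth Z j           ≤⟨ nth-mono-≤ Z↑ j≤index (proj₁ (proj₂ (∈⇒nth (f∈Z q)))) ⟩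
      nth Z (index q)   ≡⟨ nth-index q ⟩
      f q               ≤⟨ f≤c q ⟩
      c                 ∎)
      where open ≤-Reasoning
    position : Fin (suc j) → Fin j
    position q = Fin.fromℕ< (index<j q)
    no-collision : ¬ ∃₂ λ p q → p Fin.< q × position p ≡ position q
    no-collision (p , q , p<q , same) = <-irrefl (cong toℕ (f-inj (begin
      f p                ≡⟨ nth-index p ⟨
      nth Z (index p)    ≡⟨ cong (nth Z) (Finₚ.fromℕ<-injective _ _ (index<j p) (index<j q) same) ⟩
      nth Z (index q)    ≡⟨ nth-index q ⟩
      f q                ∎))) p<q
      where open ≡-Reasoning

  nth-≤-of-injection-but-one : (f : Fin (suc (suc j)) → ℕ) → Injective _≡_ _≡_ f →
    (∀ q → f q ∈ₗ Z) → (∀ {p q} → c < f p → c < f q → p ≡ q) → nth Z j ≤ c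
  nth-≤-of-injection-but-one f f-inj f∈Z unique-large with Finₚ.any? (λ q → c <? f q)
  ... | yes (p , c<fp) = nth-≤-of-injection (f ∘ punchIn p)
          (Finₚ.punchIn-injective p _ _ ∘ f-inj) (f∈Z ∘ punchIn p)
          (λ q → ≮⇒≥ λ c<fq → Finₚ.punchInᵢ≢i p q (unique-large c<fq c<fp))
  ... | no  none       = nth-≤-of-injection (f ∘ Fin.suc) (Finₚ.suc-injective ∘ f-inj) (f∈Z ∘ Fin.suc)
          (λ q → ≮⇒≥ λ c<fq → none (Fin.suc q , c<fq))

module StrictIncProperties {n} {v : Vec ℕ n} (v↑ : StrictInc v) where

  mono-≤ : ∀ {i j} → i Fin.≤ j → lookup v i ≤ lookup v j
  mono-≤ {i} {j} i≤j with toℕ i ≟ toℕ j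
  ... | yes i≡j = ≤-reflexive (cong (lookup v) (Finₚ.toℕ-injective i≡j))
  ... | no  i≢j = <⇒≤ (v↑ i j (≤∧≢⇒< i≤j i≢j))

  cancel-< : ∀ {i j} → lookup v i < lookup v j → i Fin.< j
  cancel-< vi<vj = ≰⇒> λ j≤i → <⇒≱ vi<vj (mono-≤ j≤i)

  cancel-≤ : ∀ {i j} → lookup v i ≤ lookup v j → i Fin.≤ j
  cancel-≤ vi≤vj = ≮⇒≥ λ j<i → <⇒≱ (v↑ _ _ j<i) vi≤vj

  injective : ∀ {i j} → lookup v i ≡ lookup v j → i ≡ j
  injective vi≡vj =
    Finₚ.toℕ-injective (≤-antisym (cancel-≤ (≤-reflexive vi≡vj)) (cancel-≤ (≤-reflexive (sym vi≡vj))))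

  squeeze : ∀ {i j p} → toℕ j ≡ suc (toℕ i) →
    lookup v i < lookup v p → lookup v p ≤ lookup v j → p ≡ j
  squeeze j≡1+i vi<vp vp≤vj =
    Finₚ.toℕ-injective (≤-antisym (cancel-≤ vp≤vj) (subst (_≤ _) (sym j≡1+i) (cancel-< vi<vp)))

prev-injective : ∀ {n} {i j : Fin n} → prev i ≡ prev j → i ≡ j
prev-injective {suc n} {zero}  {zero}  _  = refl
prev-injective {suc n} {zero}  {Fin.suc j} eq = contradiction eq Finₚ.fromℕ≢inject₁
prev-injective {suc n} {Fin.suc i} {zero}  eq = contradiction (sym eq) Finₚ.fromℕ≢inject₁
prev-injective {suc n} {Fin.suc i} {Fin.suc j} eq = cong Fin.suc (Finₚ.inject₁-injective eq)

prev-successor : ∀ {n} {i j : Fin n} → toℕ j ≡ suc (toℕ i) → prev j ≡ i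
prev-successor {suc n} {i} {Fin.suc j} j≡1+i =
  Finₚ.toℕ-injective (trans (Finₚ.toℕ-inject₁ j) (suc-injective j≡1+i))

prev-suc< : ∀ {n} (i : Fin n) → prev (Fin.suc i) Fin.< Fin.suc i
prev-suc< i = s≤s (≤-reflexive (Finₚ.toℕ-inject₁ i))

∈⇒lookup : ∀ {n x} {v : Vec ℕ n} → x ∈ v → ∃ λ i → lookup v i ≡ x
∈⇒lookup x∈v = VecAny.index x∈v , sym (VecAnyₚ.lookup-index x∈v)

lookup-∈ : ∀ {n x} (v : Vec ℕ n) i → lookup v i ≡ x → x ∈ v
lookup-∈ v i refl = Vec∈ₚ.∈-lookup i v

common-entries-≡ : ∀ {n} (u v : Vec ℕ n) → StrictInc u → StrictInc v →
  filter (_∈? u) (toList v) ≡ filter (_∈? v) (toList u)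
common-entries-≡ u v u↑ v↑ = strictlySorted-≡
  (AllPairsₚ.filter⁺ (_∈? u) (strictInc⇒sorted v v↑))
  (AllPairsₚ.filter⁺ (_∈? v) (strictInc⇒sorted u u↑))
  (swap-filter u v) (swap-filter v u)
  where
  swap-filter : ∀ u v {x} → x ∈ₗ filter (_∈? u) (toList v) → x ∈ₗ filter (_∈? v) (toList u)
  swap-filter u v x∈ with List∈ₚ.∈-filter⁻ (_∈? u) x∈
  ... | x∈v , x∈u = List∈ₚ.∈-filter⁺ (_∈? v) (Vec∈ₚ.∈-toList⁺ x∈u) (Vec∈ₚ.∈-toList⁻ x∈v)

strictInc-≡ : ∀ {n} (u v : Vec ℕ n) → StrictInc u → StrictInc v →
  (∀ {x} → x ∈ u → x ∈ v) → (∀ {x} → x ∈ v → x ∈ u) → u ≡ v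
strictInc-≡ u v u↑ v↑ u⊆v v⊆u = trans (sym (Vecₚ.cast-is-id refl u)) (Vecₚ.toList-injective refl u v
  (strictlySorted-≡ (strictInc⇒sorted u u↑) (strictInc⇒sorted v v↑)
    (Vec∈ₚ.∈-toList⁺ ∘ u⊆v ∘ Vec∈ₚ.∈-toList⁻) (Vec∈ₚ.∈-toList⁺ ∘ v⊆u ∘ Vec∈ₚ.∈-toList⁻)))

Recovered : ∀ {n} → Tab n → ℕ → Set
Recovered S x = (x ∈ row1 S × ¬ x ∈ row2 S) ⊎ ∃ λ i → lookup (row2 S) i ≡ x × lookup (row2 S) (prev i) ∈ row1 S

module Arrays (n' m k : ℕ) where

  N : ℕ
  N = suc n'

  module PrimeArray (T : Tab N) (T-prime : PRInc m k N T) where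

    r₁ r₂ : Fin N → ℕ
    r₁ = lookup (row1 T)
    r₂ = lookup (row2 T)

    row₁↑ : StrictInc (row1 T)
    row₁↑ = proj₁ (proj₁ T-prime)

    row₂↑ : StrictInc (row2 T)
    row₂↑ = proj₁ (proj₂ (proj₁ T-prime))

    col≤ : ∀ j → r₁ j ≤ r₂ j
    col≤ = proj₁ (proj₂ (proj₂ (proj₁ T-prime)))

    entries : ∀ x → Appears T x ⇔ (suc m ≤ x × x ≤ m + (2 * N ∸ k))
    entries = proj₂ (proj₂ (proj₂ (proj₁ T-prime)))

    prime : Prime T
    prime = proj₂ T-prime

    module R₁ = StrictIncProperties {v = row1 T} row₁↑
    module R₂ = StrictIncProperties {v = row2 T} row₂↑

    r₁∈ : ∀ j → r₁ j ∈ row1 T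
    r₁∈ j = Vec∈ₚ.∈-lookup j (row1 T)

    r₂∈ : ∀ j → r₂ j ∈ row2 T
    r₂∈ j = Vec∈ₚ.∈-lookup j (row2 T)

    data NewEntry (x : ℕ) : Set where
      unshared       : x ∈ row1 T → ¬ x ∈ row2 T → NewEntry x
      left-of-shared : ∀ i → r₂ i ∈ row1 T → r₂ (prev i) ≡ x → NewEntry x

    L : List ℕ
    L = rowOneMinusA T ++ setB T

    ∈L⇒NewEntry : ∀ {x} → x ∈ₗ L → NewEntry x
    ∈L⇒NewEntry x∈L with List∈ₚ.∈-++⁻ (rowOneMinusA T) x∈L
    ... | inj₁ x∈row₁∖A with List∈ₚ.∈-filter⁻ (λ x → ¬? (x ∈? row2 T)) x∈row₁∖A
    ...   | x∈row₁ , x∉row₂ = unshared (Vec∈ₚ.∈-toList⁻ x∈row₁) x∉row₂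
    ∈L⇒NewEntry x∈L | inj₂ x∈B with List∈ₚ.∈-map⁻ (r₂ ∘ prev) x∈B
    ...   | i , i∈ , refl = left-of-shared i (proj₂ (List∈ₚ.∈-filter⁻ (λ i → r₂ i ∈? row1 T) i∈)) refl

    NewEntry⇒∈L : ∀ {x} → NewEntry x → x ∈ₗ L
    NewEntry⇒∈L (unshared x∈row₁ x∉row₂) = List∈ₚ.∈-++⁺ˡ
      (List∈ₚ.∈-filter⁺ (λ x → ¬? (x ∈? row2 T)) (Vec∈ₚ.∈-toList⁺ x∈row₁) x∉row₂)
    NewEntry⇒∈L (left-of-shared i r₂i∈row₁ refl) = List∈ₚ.∈-++⁺ʳ (rowOneMinusA T)
      (List∈ₚ.∈-map⁺ (r₂ ∘ prev) (List∈ₚ.∈-filter⁺ (λ i → r₂ i ∈? row1 T) (List∈ₚ.∈-allFin i) r₂i∈row₁))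

    unique-L : Unique L
    unique-L = Uniqueₚ.++⁺
      (Uniqueₚ.filter⁺ (λ x → ¬? (x ∈? row2 T)) (AllPairs.map <⇒≢ (strictInc⇒sorted (row1 T) row₁↑)))
      (Uniqueₚ.map⁺ (prev-injective ∘ R₂.injective) (Uniqueₚ.filter⁺ (λ i → r₂ i ∈? row1 T) (Uniqueₚ.allFin⁺ N)))
      disjoint
      where
      disjoint : ∀ {x} → ¬ (x ∈ₗ rowOneMinusA T × x ∈ₗ setB T)
      disjoint (x∈row₁∖A , x∈B) with List∈ₚ.∈-filter⁻ (λ x → ¬? (x ∈? row2 T)) {xs = toList (row1 T)} x∈row₁∖A
                                    | List∈ₚ.∈-map⁻ (r₂ ∘ prev) x∈B
      ... | _ , x∉row₂ | i , _ , refl = x∉row₂ (r₂∈ (prev i))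

    length-L : length L ≡ N
    length-L = begin
      length L                                                  ≡⟨ Listₚ.length-++ (rowOneMinusA T) ⟩
      length (rowOneMinusA T) + length (setB T)                 ≡⟨ cong (length (rowOneMinusA T) +_) length-B ⟩
      length (rowOneMinusA T) + length (filter (_∈? row2 T) (toList (row1 T)))
                                                                ≡⟨ length-filter-∁ (_∈? row2 T) (toList (row1 T)) ⟩
      length (toList (row1 T))                                  ≡⟨ Vecₚ.length-toList (row1 T) ⟩
      N                                                         ∎
      where
      open ≡-Reasoning
      length-B : length (setB T) ≡ length (filter (_∈? row2 T) (toList (row1 T)))
      length-B = begin
        length (setB T)                                         ≡⟨ Listₚ.length-map (r₂ ∘ prev) shared-columns ⟩
        length shared-columns                                   ≡⟨ length-filter-map (_∈? row1 T) r₂ (allFin N) ⟨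
        length (filter (_∈? row1 T) (List.map r₂ (allFin N)))   ≡⟨ cong (length ∘ filter (_∈? row1 T)) row₂-as-map ⟨
        length (filter (_∈? row1 T) (toList (row2 T)))
          ≡⟨ cong length (common-entries-≡ (row1 T) (row2 T) row₁↑ row₂↑) ⟩
        length (filter (_∈? row2 T) (toList (row1 T)))          ∎
        where
        shared-columns : List (Fin N)
        shared-columns = filter (λ i → r₂ i ∈? row1 T) (allFin N)
        row₂-as-map : toList (row2 T) ≡ List.map r₂ (allFin N)
        row₂-as-map = trans (toList≡tabulate-lookup (row2 T)) (sym (Listₚ.map-tabulate (λ i → i) r₂))

    Z : List ℕ
    Z = isort L

    Z↑ : StrictlySorted Z
    Z↑ = isort-sorted unique-L

    length-Z : length Z ≡ N
    length-Z = trans (↭-length (isort-↭ L)) length-L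

    <length-Z : ∀ (j : Fin N) → toℕ j < length Z
    <length-Z j = subst (toℕ j <_) (sym length-Z) (Finₚ.toℕ<n j)

    w : Vec ℕ N
    w = row1 (g T)

    lookup-w : ∀ j → lookup w j ≡ nth Z (toℕ j)
    lookup-w = Vecₚ.lookup∘tabulate (nth Z ∘ toℕ)

    NewEntry⇒∈Z : ∀ {x} → NewEntry x → x ∈ₗ Z
    NewEntry⇒∈Z = ∈-resp-↭ (↭-sym (isort-↭ L)) ∘ NewEntry⇒∈L

    ∈w⇒NewEntry : ∀ {x} → x ∈ w → NewEntry x
    ∈w⇒NewEntry x∈w with ∈⇒lookup x∈w
    ... | j , refl = ∈L⇒NewEntry (∈-resp-↭ (isort-↭ L)
                       (subst (_∈ₗ Z) (sym (lookup-w j)) (nth-∈ Z (<length-Z j))))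

    NewEntry⇒∈w : ∀ {x} → NewEntry x → x ∈ w
    NewEntry⇒∈w x-new with ∈⇒nth (NewEntry⇒∈Z x-new)
    ... | i , i<length , refl = lookup-∈ w j (trans (lookup-w j) (cong (nth Z) (Finₚ.toℕ-fromℕ< i<N)))
      where
      i<N : i < N
      i<N = subst (i <_) length-Z i<length
      j : Fin N
      j = Fin.fromℕ< i<N

    shift : Fin N → ℕ
    shift q with r₁ q ∈? row2 T
    ... | yes r₁q∈row₂ = r₂ (prev (VecAny.index r₁q∈row₂))
    ... | no  _        = r₁ q

    data ShiftView (q : Fin N) : ℕ → Set where
      unshared : ¬ r₁ q ∈ row2 T → ShiftView q (r₁ q)
      shared   : ∀ p → r₂ p ≡ r₁ q → ShiftView q (r₂ (prev p))

    shift-view : ∀ q → ShiftView q (shift q)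
    shift-view q with r₁ q ∈? row2 T
    ... | yes r₁q∈row₂ = shared (VecAny.index r₁q∈row₂) (sym (VecAnyₚ.lookup-index r₁q∈row₂))
    ... | no  r₁q∉row₂ = unshared r₁q∉row₂

    shift-new : ∀ q → NewEntry (shift q)
    shift-new q with shift q | shift-view q
    ... | _ | unshared r₁q∉row₂ = unshared (r₁∈ q) r₁q∉row₂
    ... | _ | shared p r₂p≡r₁q  = left-of-shared p (subst (_∈ row1 T) (sym r₂p≡r₁q) (r₁∈ q)) refl

    shift-injective : Injective _≡_ _≡_ shift
    shift-injective {q₁} {q₂} eq with shift q₁ | shift-view q₁ | shift q₂ | shift-view q₂
    ... | _ | unshared _  | _ | unshared _ = R₁.injective eq
    ... | _ | unshared r₁q₁∉row₂ | _ | shared p₂ _ = contradiction (lookup-∈ (row2 T) (prev p₂) (sym eq)) r₁q₁∉row₂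
    ... | _ | shared p₁ _ | _ | unshared r₁q₂∉row₂ = contradiction (lookup-∈ (row2 T) (prev p₁) eq) r₁q₂∉row₂
    ... | _ | shared p₁ r₂p₁≡r₁q₁ | _ | shared p₂ r₂p₂≡r₁q₂ = R₁.injective (begin
      r₁ q₁ ≡⟨ r₂p₁≡r₁q₁ ⟨
      r₂ p₁ ≡⟨ cong r₂ (prev-injective (R₂.injective eq)) ⟩
      r₂ p₂ ≡⟨ r₂p₂≡r₁q₂ ⟩
      r₁ q₂ ∎)
      where open ≡-Reasoning

    shift-≤ : ∀ q → r₂ zero ≢ r₁ q → shift q ≤ r₁ q
    shift-≤ q r₂0≢r₁q with shift q | shift-view q
    ... | _ | unshared _              = ≤-refl
    ... | _ | shared zero r₂0≡r₁q = contradiction r₂0≡r₁q r₂0≢r₁q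
    ... | _ | shared (Fin.suc p) r₂p≡r₁q = subst (_ ≤_) r₂p≡r₁q (<⇒≤ (row₂↑ _ _ (prev-suc< p)))

    successor-appears : ∀ {j j' : Fin N} → toℕ j' ≡ suc (toℕ j) → Appears T (suc (r₂ j))
    successor-appears {j} {j'} j'≡1+j = Equivalence.from (entries (suc (r₂ j)))
      (m≤n⇒m≤1+n (proj₁ (range j)) , ≤-trans (row₂↑ j j' (≤-reflexive (sym j'≡1+j))) (proj₂ (range j')))
      where
      range : ∀ i → suc m ≤ r₂ i × r₂ i ≤ m + (2 * N ∸ k)
      range i = Equivalence.to (entries (r₂ i)) (inj₂ (r₂∈ i))

    -- The value r₂ j + 1 appears in T, and the gap forces it into column j'.
    gap⇒shared : ∀ {j j' : Fin N} → toℕ j' ≡ suc (toℕ j) → r₂ j < r₁ j' → r₂ j' ∈ row1 T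
    gap⇒shared {j} {j'} j'≡1+j r₂j<r₁j' with successor-appears j'≡1+j
    ... | inj₁ in-row₁ with (p , r₁p≡1+r₂j) ← ∈⇒lookup in-row₁ =
      prime j j' j'≡1+j (subst (λ i → r₁ i ≡ suc (r₂ j)) p≡j' r₁p≡1+r₂j)
      where
      p≡j' : p ≡ j'
      p≡j' = R₁.squeeze j'≡1+j (≤-<-trans (col≤ j) (subst (r₂ j <_) (sym r₁p≡1+r₂j) (n<1+n _)))
                                (subst (_≤ r₁ j') (sym r₁p≡1+r₂j) r₂j<r₁j')
    ... | inj₂ in-row₂ with (p , r₂p≡1+r₂j) ← ∈⇒lookup in-row₂ =
      lookup-∈ (row1 T) j' (≤-antisym (col≤ j') (subst (_≤ r₁ j') r₂p≡r₂j' r₂j<r₁j'))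
      where
      p≡j' : p ≡ j'
      p≡j' = R₂.squeeze j'≡1+j (subst (r₂ j <_) (sym r₂p≡1+r₂j) (n<1+n _))
                                (subst (_≤ r₂ j') (sym r₂p≡1+r₂j) (≤-trans r₂j<r₁j' (col≤ j')))
      r₂p≡r₂j' : suc (r₂ j) ≡ r₂ j'
      r₂p≡r₂j' = trans (sym r₂p≡1+r₂j) (cong r₂ p≡j')

    fresh-entry : ∀ {j j' : Fin N} → toℕ j' ≡ suc (toℕ j) → r₂ zero ≢ r₁ j' →
      ∃ λ e → NewEntry e × e ≤ r₂ j × (∀ q → q Fin.≤ j → shift q ≢ e)
    fresh-entry {j} {j'} j'≡1+j r₂0≢r₁j' with r₁ j' ≤? r₂ j
    ... | yes r₁j'≤r₂j = shift j' , shift-new j' , ≤-trans (shift-≤ j' r₂0≢r₁j') r₁j'≤r₂j ,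
            λ q q≤j eq → 1+n≰n (subst (_≤ toℕ j) (trans (cong toℕ (shift-injective eq)) j'≡1+j) q≤j)
    ... | no  r₁j'≰r₂j =
      r₂ j , left-of-shared j' (gap⇒shared j'≡1+j (≰⇒> r₁j'≰r₂j)) (cong r₂ (prev-successor j'≡1+j)) , ≤-refl , fresh
      where
      fresh : ∀ q → q Fin.≤ j → shift q ≢ r₂ j
      fresh q q≤j eq with shift q | shift-view q
      ... | _ | unshared r₁q∉row₂ = r₁q∉row₂ (lookup-∈ (row2 T) j (sym eq))
      ... | _ | shared p r₂p≡r₁q  = <⇒≱ (row₂↑ j j' (≤-reflexive (sym j'≡1+j))) (begin
        r₂ j'  ≡⟨ cong r₂ (prev-injective (trans (R₂.injective eq) (sym (prev-successor j'≡1+j)))) ⟨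
        r₂ p   ≡⟨ r₂p≡r₁q ⟩
        r₁ q   ≤⟨ R₁.mono-≤ q≤j ⟩
        r₁ j   ≤⟨ col≤ j ⟩
        r₂ j   ∎)
        where open ≤-Reasoning

    column : ∀ j → Fin (suc (toℕ j)) → Fin N
    column j q = Fin.inject≤ q (Finₚ.toℕ<n j)

    column≤ : ∀ j q → column j q Fin.≤ j
    column≤ j q = subst (_≤ toℕ j) (sym (Finₚ.toℕ-inject≤ q (Finₚ.toℕ<n j))) (s≤s⁻¹ (Finₚ.toℕ<n q))

    shifts : ∀ j → Fin (suc (toℕ j)) → ℕ
    shifts j = shift ∘ column j

    shifts-injective : ∀ j → Injective _≡_ _≡_ (shifts j)
    shifts-injective j = Finₚ.inject≤-injective _ _ _ _ ∘ shift-injective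

    shifts∈Z : ∀ j q → shifts j q ∈ₗ Z
    shifts∈Z j q = NewEntry⇒∈Z (shift-new (column j q))

    nth-≤-by-columns : ∀ j {c} → (∀ q → q Fin.≤ j → shift q ≤ c) → nth Z (toℕ j) ≤ c
    nth-≤-by-columns j shift≤c =
      nth-≤-of-injection Z↑ (<length-Z j) (shifts j) (shifts-injective j) (shifts∈Z j)
        (λ q → shift≤c (column j q) (column≤ j q))

    module _ {j : Fin N} {c e : ℕ} (e-new : NewEntry e) (e≤c : e ≤ c) (e-fresh : ∀ q → q Fin.≤ j → shift q ≢ e) where

      private
        extended-injective : Injective _≡_ _≡_ (e ◂ shifts j)
        extended-injective = ◂-injective (shifts-injective j) (λ q → e-fresh (column j q) (column≤ j q))

        extended∈Z : ∀ q → (e ◂ shifts j) q ∈ₗ Z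
        extended∈Z zero    = NewEntry⇒∈Z e-new
        extended∈Z (Fin.suc q) = shifts∈Z j q

      nth-≤-by-columns-and-fresh : ∀ {j' : Fin N} → toℕ j' ≡ suc (toℕ j) → (∀ q → q Fin.≤ j → shift q ≤ c) →
        nth Z (toℕ j') ≤ c
      nth-≤-by-columns-and-fresh {j'} j'≡1+j shift≤c = subst (λ i → nth Z i ≤ c) (sym j'≡1+j)
        (nth-≤-of-injection Z↑ (subst (_< length Z) j'≡1+j (<length-Z j')) (e ◂ shifts j)
          extended-injective extended∈Z bound)
        where
        bound : ∀ q → (e ◂ shifts j) q ≤ c
        bound zero    = e≤c
        bound (Fin.suc q) = shift≤c (column j q) (column≤ j q)

      nth-≤-by-columns-but-one : (∀ {p q} → p Fin.≤ j → q Fin.≤ j → c < shift p → c < shift q → p ≡ q) →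
        nth Z (toℕ j) ≤ c
      nth-≤-by-columns-but-one unique-large =
        nth-≤-of-injection-but-one Z↑ (<length-Z j) (e ◂ shifts j) extended-injective extended∈Z large-unique
        where
        large-unique : ∀ {p q} → c < (e ◂ shifts j) p → c < (e ◂ shifts j) q → p ≡ q
        large-unique {zero}  c<e _ = contradiction e≤c (<⇒≱ c<e)
        large-unique {Fin.suc _} {zero} _ c<e = contradiction e≤c (<⇒≱ c<e)
        large-unique {Fin.suc p} {Fin.suc q} c<p c<q =
          cong Fin.suc (Finₚ.inject≤-injective _ _ _ _ (unique-large (column≤ j p) (column≤ j q) c<p c<q))

    successor≰ : ∀ {j j' q : Fin N} → toℕ j' ≡ suc (toℕ j) → q Fin.≤ j → q ≢ j'
    successor≰ {j} j'≡1+j q≤j refl = 1+n≰n (subst (_≤ toℕ j) j'≡1+j q≤j)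

    shift≤r₂ : ∀ {q j : Fin N} → q Fin.≤ j → r₂ zero ≢ r₁ q → shift q ≤ r₂ j
    shift≤r₂ {q} {j} q≤j r₂0≢r₁q = ≤-trans (shift-≤ q r₂0≢r₁q) (≤-trans (R₁.mono-≤ q≤j) (col≤ j))

    large-shift : ∀ {q j : Fin N} → q Fin.≤ j → r₂ j < shift q → r₂ zero ≡ r₁ q
    large-shift {q} q≤j r₂j<shift with r₂ zero ≟ r₁ q
    ... | yes r₂0≡r₁q = r₂0≡r₁q
    ... | no  r₂0≢r₁q = contradiction (shift≤r₂ q≤j r₂0≢r₁q) (<⇒≱ r₂j<shift)

    ≤last : ∀ {j : Fin N} → toℕ j ≡ n' → ∀ p → p Fin.≤ j
    ≤last j≡n' p = subst (toℕ p ≤_) (sym j≡n') (s≤s⁻¹ (Finₚ.toℕ<n p))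

    NewEntry≤last : ∀ {x} {j : Fin N} → toℕ j ≡ n' → NewEntry x → x ≤ r₂ j
    NewEntry≤last j≡n' (unshared x∈row₁ _) with ∈⇒lookup x∈row₁
    ... | p , refl = ≤-trans (col≤ p) (R₂.mono-≤ (≤last j≡n' p))
    NewEntry≤last j≡n' (left-of-shared i _ refl) = R₂.mono-≤ (≤last j≡n' (prev i))

    g-col≤-before-successor : ∀ {j j' : Fin N} → toℕ j' ≡ suc (toℕ j) → nth Z (toℕ j) ≤ r₂ j
    g-col≤-before-successor {j} {j'} j'≡1+j with r₂ zero ≟ r₁ j'
    ... | yes r₂0≡r₁j' = nth-≤-by-columns j λ q q≤j →
            shift≤r₂ q≤j (λ r₂0≡r₁q → successor≰ j'≡1+j q≤j (R₁.injective (trans (sym r₂0≡r₁q) r₂0≡r₁j')))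
    ... | no  r₂0≢r₁j' with fresh-entry j'≡1+j r₂0≢r₁j'
    ...   | e , e-new , e≤r₂j , e-fresh = nth-≤-by-columns-but-one e-new e≤r₂j e-fresh
            λ p≤j q≤j large-p large-q → R₁.injective (trans (sym (large-shift p≤j large-p)) (large-shift q≤j large-q))

    g-col≤ : ∀ j → nth Z (toℕ j) ≤ r₂ j
    g-col≤ j with <-cmp (toℕ j) n'
    ... | tri< j<n' _ _ = g-col≤-before-successor (Finₚ.toℕ-fromℕ< (s≤s j<n'))
    ... | tri≈ _ j≡n' _ = nth-≤-by-columns j λ q _ → NewEntry≤last j≡n' (shift-new q)
    ... | tri> _ _ n'<j = contradiction (s≤s⁻¹ (Finₚ.toℕ<n j)) (<⇒≱ n'<j)

    ∉row₁⇒≢r₁ : ∀ {x} → ¬ x ∈ row1 T → ∀ q → x ≢ r₁ q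
    ∉row₁⇒≢r₁ x∉row₁ q refl = x∉row₁ (r₁∈ q)

    g-shifted-col≤ : ¬ r₂ zero ∈ row1 T → ∀ {i i' : Fin N} → toℕ i' ≡ suc (toℕ i) → nth Z (toℕ i') ≤ r₂ i
    g-shifted-col≤ r₂0∉row₁ i'≡1+i with fresh-entry i'≡1+i (∉row₁⇒≢r₁ r₂0∉row₁ _)
    ... | e , e-new , e≤r₂i , e-fresh =
      nth-≤-by-columns-and-fresh e-new e≤r₂i e-fresh i'≡1+i λ q q≤i → shift≤r₂ q≤i (∉row₁⇒≢r₁ r₂0∉row₁ q)

    last : Fin N
    last = fromℕ n'

    r₂0∈row₁⇒g-last-equal : r₂ zero ∈ row1 T → lookup w last ≡ r₂ last
    r₂0∈row₁⇒g-last-equal r₂0∈row₁ with ∈⇒nth (NewEntry⇒∈Z (left-of-shared zero r₂0∈row₁ refl))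
    ... | i , i<length , Zi≡r₂last = trans (lookup-w last) (≤-antisym (g-col≤ last) (begin
      r₂ last           ≡⟨ Zi≡r₂last ⟨
      nth Z i           ≤⟨ nth-mono-≤ Z↑ i≤n' (<length-Z last) ⟩
      nth Z (toℕ last)  ∎))
      where
      open ≤-Reasoning
      i≤n' : i ≤ toℕ last
      i≤n' = subst (i ≤_) (sym (Finₚ.toℕ-fromℕ n')) (s≤s⁻¹ (subst (i <_) length-Z i<length))

    g-last-equal⇒r₂0∈row₁ : lookup w last ≡ r₂ last → r₂ zero ∈ row1 T
    g-last-equal⇒r₂0∈row₁ w-last≡r₂-last with ∈w⇒NewEntry (lookup-∈ w last w-last≡r₂-last)
    ... | unshared _ r₂last∉row₂ = contradiction (r₂∈ last) r₂last∉row₂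
    ... | left-of-shared i r₂i∈row₁ r₂-prev-i≡r₂-last =
      subst (λ i → r₂ i ∈ row1 T) (prev-injective (R₂.injective r₂-prev-i≡r₂-last)) r₂i∈row₁

    g-RInc : RInc m k N (g T)
    g-RInc = w↑ , row₂↑ , g-col , λ x →
      mk⇔ (Equivalence.to (entries x) ∘ g⇒T) (T⇒g ∘ Equivalence.from (entries x))
      where
      w↑ : StrictInc w
      w↑ i j i<j = subst₂ _<_ (sym (lookup-w i)) (sym (lookup-w j)) (nth-mono-< Z↑ i<j (<length-Z j))
      g-col : ∀ j → lookup w j ≤ r₂ j
      g-col j = subst (_≤ r₂ j) (sym (lookup-w j)) (g-col≤ j)
      g⇒T : ∀ {x} → Appears (g T) x → Appears T x
      g⇒T (inj₂ x∈row₂) = inj₂ x∈row₂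
      g⇒T (inj₁ x∈w) with ∈w⇒NewEntry x∈w
      ... | unshared x∈row₁ _ = inj₁ x∈row₁
      ... | left-of-shared i _ refl = inj₂ (r₂∈ (prev i))
      T⇒g : ∀ {x} → Appears T x → Appears (g T) x
      T⇒g (inj₂ x∈row₂) = inj₂ x∈row₂
      T⇒g {x} (inj₁ x∈row₁) with x ∈? row2 T
      ... | yes x∈row₂ = inj₂ x∈row₂
      ... | no  x∉row₂ = inj₁ (NewEntry⇒∈w (unshared x∈row₁ x∉row₂))

    ∈row₁⇔Recovered : ∀ x → x ∈ row1 T ⇔ Recovered (g T) x
    ∈row₁⇔Recovered x = mk⇔ to from
      where
      to : x ∈ row1 T → Recovered (g T) x
      to x∈row₁ with x ∈? row2 T
      ... | no  x∉row₂ = inj₁ (NewEntry⇒∈w (unshared x∈row₁ x∉row₂) , x∉row₂)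
      ... | yes x∈row₂ with ∈⇒lookup x∈row₂
      ...   | i , refl = inj₂ (i , refl , NewEntry⇒∈w (left-of-shared i x∈row₁ refl))
      from : Recovered (g T) x → x ∈ row1 T
      from (inj₁ (x∈w , x∉row₂)) with ∈w⇒NewEntry x∈w
      ... | unshared x∈row₁ _       = x∈row₁
      ... | left-of-shared i _ refl = contradiction (r₂∈ (prev i)) x∉row₂
      from (inj₂ (i , refl , r₂-prev-i∈w)) with ∈w⇒NewEntry r₂-prev-i∈w
      ... | unshared _ r₂-prev-i∉row₂ = contradiction (r₂∈ (prev i)) r₂-prev-i∉row₂
      ... | left-of-shared i′ r₂i′∈row₁ r₂-prev-i′≡ =
        subst (λ i → r₂ i ∈ row1 T) (prev-injective (R₂.injective r₂-prev-i′≡)) r₂i′∈row₁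

  row1-⊆ : ∀ {T T′ : Tab N} → PRInc m k N T → PRInc m k N T′ →
    g T ≡ g T′ → ∀ {x} → x ∈ row1 T → x ∈ row1 T′
  row1-⊆ {T} {T′} T-prime T′-prime gT≡gT′ {x} =
    Equivalence.from (PrimeArray.∈row₁⇔Recovered T′ T′-prime x) ∘ subst (λ S → Recovered S x) gT≡gT′
    ∘ Equivalence.to (PrimeArray.∈row₁⇔Recovered T T-prime x)

  g-injective : ∀ {T T′ : Tab N} → PRInc m k N T → PRInc m k N T′ →
    g T ≡ g T′ → T ≡ T′
  g-injective {T = T} {T′} T-prime T′-prime gT≡gT′ = cong₂ tab row₁≡ (cong row2 gT≡gT′)
    where
    row₁≡ : row1 T ≡ row1 T′
    row₁≡ = strictInc-≡ (row1 T) (row1 T′) (proj₁ (proj₁ T-prime)) (proj₁ (proj₁ T′-prime))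
      (row1-⊆ T-prime T′-prime gT≡gT′) (row1-⊆ T′-prime T-prime (sym gT≡gT′))

lemma3p1 : (n' m k : ℕ) →
    ((T : Tab (suc n')) → PRInc m k (suc n') T → RInc m k (suc n') (g T)) ×
    ((T T′ : Tab (suc n')) → PRInc m k (suc n') T → PRInc m k (suc n') T′ →
      g T ≡ g T′ → T ≡ T′) ×
    ((T : Tab (suc n')) → PRInc m k (suc n') T →
      ((¬ (lookup (row2 T) zero ∈ row1 T)) →
        (i i′ : Fin (suc n')) → toℕ i′ ≡ suc (toℕ i) →
        lookup (row1 (g T)) i′ ≤ lookup (row2 (g T)) i) ×
      ((lookup (row2 T) zero ∈ row1 T) ⇔
        (lookup (row1 (g T)) (fromℕ n') ≡ lookup (row2 (g T)) (fromℕ n'))))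
lemma3p1 n' m k = let open Arrays n' m k in
  (λ T T-prime → PrimeArray.g-RInc T T-prime) ,
  (λ T T′ → g-injective) ,
  λ T T-prime → let open PrimeArray T T-prime in
    (λ r₂0∉row₁ i i′ i′≡1+i → subst (_≤ r₂ i) (sym (lookup-w i′)) (g-shifted-col≤ r₂0∉row₁ i′≡1+i)) ,
    mk⇔ r₂0∈row₁⇒g-last-equal g-last-equal⇒r₂0∈row₁
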